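{- There exists an orthogonal design $OD\big(2^{10};\ 2^6_{(16)}\big)$, i.e. a square matrix $X$ of order $2^{10}$ with entries in $\{0,\pm z_1,\ldots,\pm z_{16}\}$ such that $XX^{\rm T}=\big(2^6\sum_{i=1}^{16}z_i^2\big)I_{2^{10}}$.
   Context: $z_1,\ldots,z_{16}$ are distinct commuting variables. The notation $u_{(k)}$ means $u$ repeated $k$ times. An orthogonal design $OD(m;c_1,\ldots,c_k)$ is a square matrix of order $m$ with entries from $\{0,\pm z_1,\ldots,\pm z_k\}$ satisfying $XX^{\rm T}=(\sum_j c_jz_j^2)I_m$. -}

module Defs where

open import Data.Nat using (ℕ; _^_)
open import Data.Fin using (Fin; _≟_)
open import Data.Integer using (ℤ; +_; -_; _+_; _*_; 0ℤ; 1ℤ)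
open import Data.Sign using (Sign)
open import Data.Bool using (Bool; true; false)
open import Relation.Nullary.Decidable using (does)
open import Relation.Binary.PropositionalEquality using (_≡_)

data Entry (k : ℕ) : Set where
  zer : Entry k
  pos : Fin k → Entry k
  neg : Fin k → Entry k

Matrix : ℕ → ℕ → Set
Matrix k m = Fin m → Fin m → Entry k

lin : ∀ {k} → Entry k → Fin k → ℤ
lin zer      a = 0ℤ
lin (pos b) a = if′ (does (b ≟ a))
  where if′ : Bool → ℤ
        if′ true  = 1ℤ
        if′ false = 0ℤ
lin (neg b) a = if′ (does (b ≟ a))
  where if′ : Bool → ℤ
        if′ true  = - 1ℤ
        if′ false = 0ℤ

sumFin : ∀ m → (Fin m → ℤ) → ℤ
sumFin ℕ.zero    f = 0ℤ
sumFin (ℕ.suc m) f = f Fin.zero + sumFin m (λ i → f (Fin.suc i))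

-- A quadratic form in commuting z_1..z_k is represented by an (unsymmetrised)
-- coefficient function q a b on ordered pairs; the coefficient of the
-- monomial z_a z_b in the polynomial is q a b + q b a (a ≠ b), resp. q a a
-- (a = b).  Two such forms are equal as polynomials iff their symmetrisations
-- agree, which is what QEq expresses (doubling is harmless over ℤ).
QForm : ℕ → Set
QForm k = Fin k → Fin k → ℤ

QEq : ∀ {k} → QForm k → QForm k → Set
QEq {k} p q = (a b : Fin k) → p a b + p b a ≡ q a b + q b a

XXᵀ : ∀ {k m} → Matrix k m → Fin m → Fin m → QForm k
XXᵀ {k} {m} X i j a b = sumFin m (λ l → lin (X i l) a * lin (X j l) b)

diagForm : ∀ {k m} → (Fin k → ℕ) → Fin m → Fin m → QForm k
diagForm c i j a b = δ (does (i ≟ j)) (does (a ≟ b))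
  where δ : Bool → Bool → ℤ
        δ true true = + (c a)
        δ _    _    = 0ℤ

IsOD : ∀ {k m} → (Fin k → ℕ) → Matrix k m → Set
IsOD {k} {m} c X = (i j : Fin m) → QEq (XXᵀ X i j) (diagForm c i j)

-- Index rows and columns by {0,1}¹⁰ and write the design as X = Σₐ zₐ Cₐ with
-- Cₐ = P₁ ⊗ ⋯ ⊗ P₄ ⊗ P₅H ⊗ ⋯ ⊗ P₁₀H, a Kronecker product of Pauli matrices Pᵢ (depending on a)
-- and the Hadamard matrix H. The X-exponents of P₁, …, P₄ spell out a in binary, so the Cₐ,
-- which are ±1 on their supports, have supports partitioning the positions: X has entries
-- in {0, ±z₁, …, ±z₁₆}.
-- By the mixed-product rule every Cₐ C_bᵀ is again a Kronecker product, of multiples of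
-- Pauli matrices. Since P Pᵀ = I and H Hᵀ = 2I, Cₐ Cₐᵀ = 2⁶ I; for a ≠ b every factor of
-- Cₐ C_bᵀ is symmetric or skew-symmetric and an odd number of them is skew, so
-- Cₐ C_bᵀ + C_b Cₐᵀ = 0. These finitely many facts are checked by evaluation.

module Submission where

open import Defs
open import Data.Nat using (ℕ; _^_)
open import Data.Fin using (Fin)
open import Data.Product using (Σ)

import Data.Nat as ℕ
open import Data.Nat using (zero; suc)

open import Data.Fin using (zero; suc; _↑ˡ_; _↑ʳ_; combine; remQuot; _≟_)
open import Data.Fin.Properties using (all?; remQuot-combine; combine-remQuot)
open import Data.Integer using (ℤ; +_; -_; _+_; _-_; _*_; 0ℤ; 1ℤ; -1ℤ; -[1+_]; ∣_∣)
import Data.Integer.Properties as ℤ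
open import Data.Bool using (Bool; true; false; _xor_; _∧_; if_then_else_)
open import Data.Bool.Properties using () renaming (_≟_ to _≟ᵇ_)
open import Data.Vec using (Vec; []; _∷_; _++_; map; lookup; replicate; zipWith; take; drop; foldr′)
open import Data.Vec.Properties using (take-zipWith; ∷-injectiveˡ; ∷-injectiveʳ; ≡-dec)
open import Data.Product using (_×_; _,_; proj₁; proj₂; uncurry)
open import Data.Sum using (_⊎_; [_,_]′)
open import Data.Unit using (tt)
open import Function using (id; _∘_; flip)
open import Relation.Nullary using (Dec; contradiction)
open import Relation.Nullary.Decidable using (yes; no; does; toWitness; dec-true; dec-false; map′; _×-dec_; _⊎-dec_)
open import Relation.Binary.PropositionalEquality
open import Algebra.Properties.CommutativeSemigroup ℤ.*-commutativeSemigroup using (interchange)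

open ≡-Reasoning

sumFin-cong : ∀ m {f g : Fin m → ℤ} → (∀ i → f i ≡ g i) → sumFin m f ≡ sumFin m g
sumFin-cong zero    f≗g = refl
sumFin-cong (suc m) f≗g = cong₂ _+_ (f≗g zero) (sumFin-cong m (f≗g ∘ suc))

sumFin-↑ : ∀ m n (f : Fin (m ℕ.+ n) → ℤ) →
           sumFin (m ℕ.+ n) f ≡ sumFin m (f ∘ (_↑ˡ n)) + sumFin n (f ∘ (m ↑ʳ_))
sumFin-↑ zero    n f = sym (ℤ.+-identityˡ _)
sumFin-↑ (suc m) n f = begin
  f zero + sumFin (m ℕ.+ n) (f ∘ suc)
    ≡⟨ cong (λ t → f zero + t) (sumFin-↑ m n (f ∘ suc)) ⟩
  f zero + (sumFin m (f ∘ suc ∘ (_↑ˡ n)) + sumFin n (f ∘ (suc m ↑ʳ_)))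
    ≡⟨ ℤ.+-assoc (f zero) _ _ ⟨
  f zero + sumFin m (f ∘ suc ∘ (_↑ˡ n)) + sumFin n (f ∘ (suc m ↑ʳ_)) ∎

sumFin-combine : ∀ m n (f : Fin (m ℕ.* n) → ℤ) →
                 sumFin (m ℕ.* n) f ≡ sumFin m (λ i → sumFin n (λ j → f (combine i j)))
sumFin-combine zero    n f = refl
sumFin-combine (suc m) n f =
  trans (sumFin-↑ n (m ℕ.* n) f)
        (cong (λ t → sumFin n (f ∘ (_↑ˡ m ℕ.* n)) + t) (sumFin-combine m n (f ∘ (n ↑ʳ_))))

sumCube : ∀ n → (Vec Bool n → ℤ) → ℤ
sumCube zero    f = f []
sumCube (suc n) f = sumCube n (f ∘ (false ∷_)) + sumCube n (f ∘ (true ∷_))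

sumCube-cong : ∀ n {f g : Vec Bool n → ℤ} → (∀ v → f v ≡ g v) → sumCube n f ≡ sumCube n g
sumCube-cong zero    f≗g = f≗g []
sumCube-cong (suc n) f≗g =
  cong₂ _+_ (sumCube-cong n (f≗g ∘ (false ∷_))) (sumCube-cong n (f≗g ∘ (true ∷_)))

sumCube-*ˡ : ∀ n c (f : Vec Bool n → ℤ) → sumCube n (λ v → c * f v) ≡ c * sumCube n f
sumCube-*ˡ zero    c f = refl
sumCube-*ˡ (suc n) c f =
  trans (cong₂ _+_ (sumCube-*ˡ n c _) (sumCube-*ˡ n c _)) (sym (ℤ.*-distribˡ-+ c _ _))

bit : Fin 2 → Bool
bit zero       = false
bit (suc zero) = true

bitIndex : Bool → Fin 2
bitIndex false = zero
bitIndex true  = suc zero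

bitIndex-bit : ∀ i → bitIndex (bit i) ≡ i
bitIndex-bit zero       = refl
bitIndex-bit (suc zero) = refl

bit-bitIndex : ∀ b → bit (bitIndex b) ≡ b
bit-bitIndex false = refl
bit-bitIndex true  = refl

-- Most significant bit first.
toBits : ∀ n → Fin (2 ^ n) → Vec Bool n
toBits zero    _ = []
toBits (suc n) i = uncurry (λ b j → bit b ∷ toBits n j) (remQuot (2 ^ n) i)

fromBits : ∀ n → Vec Bool n → Fin (2 ^ n)
fromBits zero    []      = zero
fromBits (suc n) (b ∷ v) = combine (bitIndex b) (fromBits n v)

toBits-combine : ∀ n b (j : Fin (2 ^ n)) → toBits (suc n) (combine b j) ≡ bit b ∷ toBits n j
toBits-combine n b j = cong (uncurry (λ b j → bit b ∷ toBits n j)) (remQuot-combine b j)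

fromBits-toBits : ∀ n i → fromBits n (toBits n i) ≡ i
fromBits-toBits zero    zero = refl
fromBits-toBits (suc n) i =
  trans (cong₂ combine (bitIndex-bit b) (fromBits-toBits n j)) (combine-remQuot {2} (2 ^ n) i)
  where b = proj₁ (remQuot {2} (2 ^ n) i)
        j = proj₂ (remQuot {2} (2 ^ n) i)

toBits-fromBits : ∀ n v → toBits n (fromBits n v) ≡ v
toBits-fromBits zero    []      = refl
toBits-fromBits (suc n) (b ∷ v) =
  trans (toBits-combine n (bitIndex b) (fromBits n v)) (cong₂ _∷_ (bit-bitIndex b) (toBits-fromBits n v))

toBits-injective : ∀ n {i j} → toBits n i ≡ toBits n j → i ≡ j
toBits-injective n {i} {j} eq =
  trans (sym (fromBits-toBits n i)) (trans (cong (fromBits n) eq) (fromBits-toBits n j))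

sumFin-toBits : ∀ n (G : Vec Bool n → ℤ) → sumFin (2 ^ n) (G ∘ toBits n) ≡ sumCube n G
sumFin-toBits zero    G = ℤ.+-identityʳ (G [])
sumFin-toBits (suc n) G = begin
  sumFin (2 ^ suc n) (G ∘ toBits (suc n))
    ≡⟨ sumFin-combine 2 (2 ^ n) _ ⟩
  sumFin 2 (λ b → sumFin (2 ^ n) (λ j → G (toBits (suc n) (combine b j))))
    ≡⟨ sumFin-cong 2 (λ b → sumFin-cong (2 ^ n) (cong G ∘ toBits-combine n b)) ⟩
  sumFin 2 (λ b → sumFin (2 ^ n) (λ j → G (bit b ∷ toBits n j)))
    ≡⟨ sumFin-cong 2 (λ b → sumFin-toBits n (G ∘ (bit b ∷_))) ⟩
  sumFin 2 (λ b → sumCube n (G ∘ (bit b ∷_)))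
    ≡⟨ cong (λ t → sumCube n (G ∘ (false ∷_)) + t) (ℤ.+-identityʳ _) ⟩
  sumCube (suc n) G ∎

-- Kronecker products of 2 × 2 matrices

all-Bool? : {P : Bool → Set} → (∀ b → Dec (P b)) → Dec (∀ b → P b)
all-Bool? P? = map′ (λ { (p₀ , p₁) false → p₀ ; (p₀ , p₁) true → p₁ }) (λ p → p false , p true)
                    (P? false ×-dec P? true)

Mat2 : Set
Mat2 = Bool → Bool → ℤ

_·_ : Mat2 → Mat2 → Mat2
(M · N) r c = M r false * N false c + M r true * N true c

transpose : Mat2 → Mat2
transpose M r c = M c r

_·ᵀ_ : Mat2 → Mat2 → Mat2
M ·ᵀ N = M · transpose N

identity : Mat2
identity false false = 1ℤ
identity true  true  = 1ℤ
identity _     _     = 0ℤ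

identity-refl : ∀ b → identity b b ≡ 1ℤ
identity-refl false = refl
identity-refl true  = refl

identity-≢ : ∀ {r c} → r ≢ c → identity r c ≡ 0ℤ
identity-≢ {false} {false} r≢c = contradiction refl r≢c
identity-≢ {false} {true}  _   = refl
identity-≢ {true}  {false} _   = refl
identity-≢ {true}  {true}  r≢c = contradiction refl r≢c

Proportional : ℤ → Mat2 → Mat2 → Set
Proportional s M N = ∀ r c → M r c ≡ s * N r c

proportional? : ∀ s M N → Dec (Proportional s M N)
proportional? s M N = all-Bool? λ r → all-Bool? λ c → M r c ℤ.≟ s * N r c

Scales : ∀ {n} → Vec ℤ n → Vec Mat2 n → Vec Mat2 n → Set
Scales ss Ms Ns = ∀ i → Proportional (lookup ss i) (lookup Ms i) (lookup Ns i)

scales? : ∀ {n} ss (Ms Ns : Vec Mat2 n) → Dec (Scales ss Ms Ns)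
scales? ss Ms Ns = all? λ i → proportional? (lookup ss i) (lookup Ms i) (lookup Ns i)

product : ∀ {n} → Vec ℤ n → ℤ
product = foldr′ _*_ 1ℤ

kron : ∀ {n} → Vec Mat2 n → Vec Bool n → Vec Bool n → ℤ
kron []       []       []       = 1ℤ
kron (M ∷ Ms) (r ∷ x) (c ∷ y) = M r c * kron Ms x y

kron-++ : ∀ {m n} (Ms : Vec Mat2 m) (Ns : Vec Mat2 n) x y →
          kron (Ms ++ Ns) x y ≡ kron Ms (take m x) (take m y) * kron Ns (drop m x) (drop m y)
kron-++ []       Ns x       y       = sym (ℤ.*-identityˡ _)
kron-++ (M ∷ Ms) Ns (r ∷ x) (c ∷ y) =
  trans (cong (M r c *_) (kron-++ Ms Ns x y)) (sym (ℤ.*-assoc (M r c) _ _))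

kron-transpose : ∀ {n} (Ms : Vec Mat2 n) x y → kron (map transpose Ms) x y ≡ kron Ms y x
kron-transpose []       []      []      = refl
kron-transpose (M ∷ Ms) (r ∷ x) (c ∷ y) = cong (M c r *_) (kron-transpose Ms x y)

kron-identity-refl : ∀ {n} (x : Vec Bool n) → kron (replicate n identity) x x ≡ 1ℤ
kron-identity-refl []      = refl
kron-identity-refl (b ∷ x) = cong₂ _*_ (identity-refl b) (kron-identity-refl x)

kron-identity-≢ : ∀ {n} (x y : Vec Bool n) → x ≢ y → kron (replicate n identity) x y ≡ 0ℤ
kron-identity-≢ []      []      x≢y = contradiction refl x≢y
kron-identity-≢ (r ∷ x) (c ∷ y) x≢y with r ≟ᵇ c
... | no  r≢c  = cong (_* kron (replicate _ identity) x y) (identity-≢ r≢c)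
... | yes refl = trans (cong (identity r r *_) (kron-identity-≢ x y (x≢y ∘ cong (r ∷_))))
                       (ℤ.*-zeroʳ (identity r r))

kron-scale : ∀ {n} ss (Ms Ns : Vec Mat2 n) → Scales ss Ms Ns →
             ∀ x y → kron Ms x y ≡ product ss * kron Ns x y
kron-scale []       []       []       _   []      []      = refl
kron-scale (s ∷ ss) (M ∷ Ms) (N ∷ Ns) M≈N (r ∷ x) (c ∷ y) =
  trans (cong₂ _*_ (M≈N zero r c) (kron-scale ss Ms Ns (M≈N ∘ suc) x y))
        (interchange s (N r c) (product ss) (kron Ns x y))

kron-mulTranspose : ∀ {n} (Ms Ns : Vec Mat2 n) x y →
  sumCube n (λ l → kron Ms x l * kron Ns y l) ≡ kron (zipWith _·ᵀ_ Ms Ns) x y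
kron-mulTranspose []       []       []      []      = refl
kron-mulTranspose {suc n} (M ∷ Ms) (N ∷ Ns) (r ∷ x) (c ∷ y) =
  trans (cong₂ _+_ (column false) (column true))
        (sym (ℤ.*-distribʳ-+ (kron (zipWith _·ᵀ_ Ms Ns) x y)
                              (M r false * N c false) (M r true * N c true)))
  where
  column : ∀ b → sumCube n (λ l → (M r b * kron Ms x l) * (N c b * kron Ns y l))
                 ≡ M r b * N c b * kron (zipWith _·ᵀ_ Ms Ns) x y
  column b = begin
    sumCube n (λ l → (M r b * kron Ms x l) * (N c b * kron Ns y l))
      ≡⟨ sumCube-cong n (λ l → interchange (M r b) (kron Ms x l) (N c b) (kron Ns y l)) ⟩
    sumCube n (λ l → (M r b * N c b) * (kron Ms x l * kron Ns y l))
      ≡⟨ sumCube-*ˡ n (M r b * N c b) (λ l → kron Ms x l * kron Ns y l) ⟩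
    M r b * N c b * sumCube n (λ l → kron Ms x l * kron Ns y l)
      ≡⟨ cong (M r b * N c b *_) (kron-mulTranspose Ms Ns x y) ⟩
    M r b * N c b * kron (zipWith _·ᵀ_ Ms Ns) x y ∎

-- Pauli matrices

-- The Pauli matrix XᶠZᶻ is encoded by its exponents (f , z).
Pauli : Set
Pauli = Bool × Bool

pattern I  = false , false
pattern X  = true  , false
pattern Z  = false , true
pattern XZ = true  , true

sign : Bool → ℤ
sign false = 1ℤ
sign true  = -1ℤ

∣sign∣ : ∀ b → ∣ sign b ∣ ≡ 1
∣sign∣ false = refl
∣sign∣ true  = refl

∣*∣≡1 : ∀ u v → ∣ u ∣ ≡ 1 → ∣ v ∣ ≡ 1 → ∣ u * v ∣ ≡ 1
∣*∣≡1 u v ∣u∣≡1 ∣v∣≡1 = trans (ℤ.abs-* u v) (cong₂ ℕ._*_ ∣u∣≡1 ∣v∣≡1)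

pauli : Pauli → Mat2
pauli (f , z) r c = if does (r xor c ≟ᵇ f) then sign (z ∧ c) else 0ℤ

hadamard : Mat2
hadamard r c = sign (r ∧ c)

pauli-zero : ∀ p r c → r xor c ≢ proj₁ p → pauli p r c ≡ 0ℤ
pauli-zero (f , z) r c ≢f rewrite dec-false (r xor c ≟ᵇ f) ≢f = refl

∣pauli∣ : ∀ p r c → r xor c ≡ proj₁ p → ∣ pauli p r c ∣ ≡ 1
∣pauli∣ (f , z) r c ≡f rewrite dec-true (r xor c ≟ᵇ f) ≡f = ∣sign∣ (z ∧ c)

∣pauli·hadamard∣ : ∀ f z r c → ∣ (pauli (f , z) · hadamard) r c ∣ ≡ 1
∣pauli·hadamard∣ = toWitness {a? = all-Bool? λ f → all-Bool? λ z → all-Bool? λ r → all-Bool? λ c →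
                                   ∣ (pauli (f , z) · hadamard) r c ∣ ℕ.≟ 1} tt

kron-pauli-zero : ∀ {n} (ps : Vec Pauli n) x y → zipWith _xor_ x y ≢ map proj₁ ps →
                  kron (map pauli ps) x y ≡ 0ℤ
kron-pauli-zero []       []      []      ≢ps = contradiction refl ≢ps
kron-pauli-zero (p ∷ ps) (r ∷ x) (c ∷ y) ≢ps = byFirstFactor (r xor c ≟ᵇ proj₁ p)
  where
  byFirstFactor : Dec (r xor c ≡ proj₁ p) → pauli p r c * kron (map pauli ps) x y ≡ 0ℤ
  byFirstFactor (no  ≢p) = cong (_* kron (map pauli ps) x y) (pauli-zero p r c ≢p)
  byFirstFactor (yes ≡p) = trans (cong (pauli p r c *_) (kron-pauli-zero ps x y (≢ps ∘ cong₂ _∷_ ≡p)))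
                                 (ℤ.*-zeroʳ (pauli p r c))

∣kron-pauli∣ : ∀ {n} (ps : Vec Pauli n) x y → zipWith _xor_ x y ≡ map proj₁ ps →
               ∣ kron (map pauli ps) x y ∣ ≡ 1
∣kron-pauli∣ []       []      []      _   = refl
∣kron-pauli∣ (p ∷ ps) (r ∷ x) (c ∷ y) ≡ps =
  ∣*∣≡1 (pauli p r c) (kron (map pauli ps) x y)
        (∣pauli∣ p r c (∷-injectiveˡ ≡ps)) (∣kron-pauli∣ ps x y (∷-injectiveʳ ≡ps))

∣kron-pauli·hadamard∣ : ∀ {n} (ps : Vec Pauli n) x y →
                        ∣ kron (map (λ p → pauli p · hadamard) ps) x y ∣ ≡ 1
∣kron-pauli·hadamard∣ []             []      []      = refl
∣kron-pauli·hadamard∣ ((f , z) ∷ ps) (r ∷ x) (c ∷ y) =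
  ∣*∣≡1 ((pauli (f , z) · hadamard) r c) (kron (map (λ p → pauli p · hadamard) ps) x y)
        (∣pauli·hadamard∣ f z r c) (∣kron-pauli·hadamard∣ ps x y)

diagForm-diagonal : ∀ {k m} (c : Fin k → ℕ) (i : Fin m) a → diagForm c i i a a ≡ + c a
diagForm-diagonal c i a rewrite dec-true (i ≟ i) refl | dec-true (a ≟ a) refl = refl

diagForm-offDiagonal : ∀ {k m} (c : Fin k → ℕ) {i j : Fin m} a b → i ≢ j → diagForm c i j a b ≡ 0ℤ
diagForm-offDiagonal c {i} {j} a b i≢j rewrite dec-false (i ≟ j) i≢j = refl

diagForm-mixed : ∀ {k m} (c : Fin k → ℕ) (i j : Fin m) {a b} → a ≢ b → diagForm c i j a b ≡ 0ℤ
diagForm-mixed c i j {a} {b} a≢b rewrite dec-false (a ≟ b) a≢b with does (i ≟ j)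
... | true  = refl
... | false = refl

XXᵀ-swap : ∀ {k m} (A : Matrix k m) i j a b → XXᵀ A i j a b ≡ XXᵀ A j i b a
XXᵀ-swap {m = m} A i j a b = sumFin-cong m (λ l → ℤ.*-comm (lin (A i l) a) (lin (A j l) b))

isOD-intro : ∀ {k m} (c : Fin k → ℕ) (A : Matrix k m) →
             (∀ i a → XXᵀ A i i a a ≡ + c a) →
             (∀ i j a → i ≢ j → XXᵀ A i j a a ≡ 0ℤ) →
             (∀ i j a b → a ≢ b → XXᵀ A i j a b + XXᵀ A j i a b ≡ 0ℤ) →
             IsOD c A
isOD-intro c A diagonal offDiagonal mixed i j a b = byCases i j a b (a ≟ b) (i ≟ j)
  where
  byCases : ∀ i j a b → Dec (a ≡ b) → Dec (i ≡ j) →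
            XXᵀ A i j a b + XXᵀ A i j b a ≡ diagForm c i j a b + diagForm c i j b a
  byCases i _ a _ (yes refl) (yes refl) = begin
    XXᵀ A i i a a + XXᵀ A i i a a
      ≡⟨ cong₂ _+_ (diagonal i a) (diagonal i a) ⟩
    + c a + + c a
      ≡⟨ cong₂ _+_ (diagForm-diagonal c i a) (diagForm-diagonal c i a) ⟨
    diagForm c i i a a + diagForm c i i a a ∎
  byCases i j a _ (yes refl) (no i≢j) = begin
    XXᵀ A i j a a + XXᵀ A i j a a
      ≡⟨ cong₂ _+_ (offDiagonal i j a i≢j) (offDiagonal i j a i≢j) ⟩
    0ℤ + 0ℤ
      ≡⟨ cong₂ _+_ (diagForm-offDiagonal c a a i≢j) (diagForm-offDiagonal c a a i≢j) ⟨
    diagForm c i j a a + diagForm c i j a a ∎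
  byCases i j a b (no a≢b) _ = begin
    XXᵀ A i j a b + XXᵀ A i j b a
      ≡⟨ cong (λ t → XXᵀ A i j a b + t) (XXᵀ-swap A i j b a) ⟩
    XXᵀ A i j a b + XXᵀ A j i a b
      ≡⟨ mixed i j a b a≢b ⟩
    0ℤ + 0ℤ
      ≡⟨ cong₂ _+_ (diagForm-mixed c i j a≢b) (diagForm-mixed c i j (a≢b ∘ sym)) ⟨
    diagForm c i j a b + diagForm c i j b a ∎

XXᵀ-kron : ∀ {k} n (A : Matrix k (2 ^ n)) (C : Fin k → Vec Mat2 n) →
           (∀ i l a → lin (A i l) a ≡ kron (C a) (toBits n i) (toBits n l)) →
           ∀ i j a b → XXᵀ A i j a b ≡ kron (zipWith _·ᵀ_ (C a) (C b)) (toBits n i) (toBits n j)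
XXᵀ-kron n A C lin-A i j a b = begin
  sumFin (2 ^ n) (λ l → lin (A i l) a * lin (A j l) b)
    ≡⟨ sumFin-cong (2 ^ n) (λ l → cong₂ _*_ (lin-A i l a) (lin-A j l b)) ⟩
  sumFin (2 ^ n) (λ l → kron (C a) x (toBits n l) * kron (C b) y (toBits n l))
    ≡⟨ sumFin-toBits n (λ v → kron (C a) x v * kron (C b) y v) ⟩
  sumCube n (λ v → kron (C a) x v * kron (C b) y v)
    ≡⟨ kron-mulTranspose (C a) (C b) x y ⟩
  kron (zipWith _·ᵀ_ (C a) (C b)) x y ∎
  where x = toBits n i
        y = toBits n j

-- Row a lists the Pauli factors of the coefficient matrix of z_a.
paulis : Fin 16 → Vec Pauli 10
paulis = lookup
  ( (I  ∷ I  ∷ I  ∷ Z  ∷ Z  ∷ XZ ∷ XZ ∷ I  ∷ XZ ∷ X  ∷ [])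
  ∷ (Z  ∷ I  ∷ I  ∷ X  ∷ XZ ∷ XZ ∷ I  ∷ XZ ∷ X  ∷ XZ ∷ [])
  ∷ (I  ∷ Z  ∷ X  ∷ Z  ∷ I  ∷ Z  ∷ Z  ∷ Z  ∷ Z  ∷ Z  ∷ [])
  ∷ (Z  ∷ Z  ∷ XZ ∷ XZ ∷ Z  ∷ X  ∷ XZ ∷ Z  ∷ Z  ∷ XZ ∷ [])
  ∷ (Z  ∷ X  ∷ I  ∷ I  ∷ I  ∷ I  ∷ XZ ∷ XZ ∷ I  ∷ XZ ∷ [])
  ∷ (I  ∷ XZ ∷ Z  ∷ XZ ∷ XZ ∷ Z  ∷ Z  ∷ Z  ∷ XZ ∷ X  ∷ [])
  ∷ (I  ∷ X  ∷ X  ∷ Z  ∷ X  ∷ Z  ∷ X  ∷ X  ∷ Z  ∷ I  ∷ [])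
  ∷ (Z  ∷ XZ ∷ X  ∷ X  ∷ X  ∷ X  ∷ Z  ∷ X  ∷ Z  ∷ I  ∷ [])
  ∷ (X  ∷ I  ∷ Z  ∷ I  ∷ X  ∷ I  ∷ XZ ∷ Z  ∷ I  ∷ XZ ∷ [])
  ∷ (XZ ∷ I  ∷ I  ∷ X  ∷ Z  ∷ Z  ∷ I  ∷ X  ∷ XZ ∷ I  ∷ [])
  ∷ (X  ∷ I  ∷ XZ ∷ I  ∷ Z  ∷ XZ ∷ XZ ∷ X  ∷ I  ∷ Z  ∷ [])
  ∷ (X  ∷ I  ∷ X  ∷ XZ ∷ XZ ∷ XZ ∷ XZ ∷ I  ∷ I  ∷ XZ ∷ [])
  ∷ (XZ ∷ X  ∷ I  ∷ Z  ∷ X  ∷ XZ ∷ XZ ∷ XZ ∷ Z  ∷ X  ∷ [])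
  ∷ (XZ ∷ X  ∷ I  ∷ XZ ∷ X  ∷ Z  ∷ XZ ∷ XZ ∷ X  ∷ XZ ∷ [])
  ∷ (XZ ∷ X  ∷ X  ∷ Z  ∷ I  ∷ I  ∷ XZ ∷ X  ∷ I  ∷ I  ∷ [])
  ∷ (X  ∷ XZ ∷ X  ∷ X  ∷ XZ ∷ I  ∷ XZ ∷ Z  ∷ X  ∷ I  ∷ [])
  ∷ [])

supportFactors : Fin 16 → Vec Mat2 4
supportFactors a = map pauli (take 4 (paulis a))

spreadFactors : Fin 16 → Vec Mat2 6
spreadFactors a = map (λ p → pauli p · hadamard) (drop 4 (paulis a))

coefficient : Fin 16 → Vec Mat2 10
coefficient a = supportFactors a ++ spreadFactors a

-- This makes the supports of the coefficient matrices partition {0,1}¹⁰ × {0,1}¹⁰.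
paulis-flips : ∀ a → map proj₁ (take 4 (paulis a)) ≡ toBits 4 a
paulis-flips = toWitness {a? = all? λ a → ≡-dec _≟ᵇ_ (map proj₁ (take 4 (paulis a))) (toBits 4 a)} tt

variableAt : Vec Bool 10 → Vec Bool 10 → Fin 16
variableAt x y = fromBits 4 (take 4 (zipWith _xor_ x y))

coefficient-zero : ∀ x y a → variableAt x y ≢ a → kron (coefficient a) x y ≡ 0ℤ
coefficient-zero x y a ≢a =
  trans (kron-++ (supportFactors a) (spreadFactors a) x y)
        (cong (_* kron (spreadFactors a) (drop 4 x) (drop 4 y))
              (kron-pauli-zero (take 4 (paulis a)) (take 4 x) (take 4 y) (≢a ∘ variableAt≡a)))
  where
  variableAt≡a : zipWith _xor_ (take 4 x) (take 4 y) ≡ map proj₁ (take 4 (paulis a)) →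
                 variableAt x y ≡ a
  variableAt≡a ≡flips = begin
    fromBits 4 (take 4 (zipWith _xor_ x y))            ≡⟨ cong (fromBits 4) (take-zipWith _xor_ x y) ⟩
    fromBits 4 (zipWith _xor_ (take 4 x) (take 4 y))   ≡⟨ cong (fromBits 4) (trans ≡flips (paulis-flips a)) ⟩
    fromBits 4 (toBits 4 a)                             ≡⟨ fromBits-toBits 4 a ⟩
    a ∎

∣coefficient∣ : ∀ x y → ∣ kron (coefficient (variableAt x y)) x y ∣ ≡ 1
∣coefficient∣ x y =
  trans (cong ∣_∣ (kron-++ (supportFactors a) (spreadFactors a) x y))
        (∣*∣≡1 (kron (supportFactors a) (take 4 x) (take 4 y))
               (kron (spreadFactors a) (drop 4 x) (drop 4 y))
               (∣kron-pauli∣ (take 4 (paulis a)) (take 4 x) (take 4 y) flips)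
               (∣kron-pauli·hadamard∣ (drop 4 (paulis a)) (drop 4 x) (drop 4 y)))
  where
  a = variableAt x y
  flips : zipWith _xor_ (take 4 x) (take 4 y) ≡ map proj₁ (take 4 (paulis a))
  flips = begin
    zipWith _xor_ (take 4 x) (take 4 y)        ≡⟨ take-zipWith _xor_ x y ⟨
    take 4 (zipWith _xor_ x y)                 ≡⟨ toBits-fromBits 4 _ ⟨
    toBits 4 a                                 ≡⟨ paulis-flips a ⟨
    map proj₁ (take 4 (paulis a)) ∎

-- Only ever applied to ±1; any other integer yields the junk entry zer.
signed : ∀ {k} → Fin k → ℤ → Entry k
signed a (+ 1)    = pos a
signed a -[1+ 0 ] = neg a
signed a _        = zer

lin-signed-self : ∀ {k} (a : Fin k) u → ∣ u ∣ ≡ 1 → lin (signed a u) a ≡ u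
lin-signed-self a (+ _)    refl rewrite dec-true (a ≟ a) refl = refl
lin-signed-self a -[1+ _ ] refl rewrite dec-true (a ≟ a) refl = refl

lin-signed-other : ∀ {k} {a b : Fin k} u → b ≢ a → lin (signed b u) a ≡ 0ℤ
lin-signed-other {a = a} {b} (+ 1)    b≢a rewrite dec-false (b ≟ a) b≢a = refl
lin-signed-other {a = a} {b} -[1+ 0 ] b≢a rewrite dec-false (b ≟ a) b≢a = refl
lin-signed-other (+ 0)           _ = refl
lin-signed-other (+ suc (suc _)) _ = refl
lin-signed-other -[1+ suc _ ]    _ = refl

entry : Vec Bool 10 → Vec Bool 10 → Entry 16
entry x y = signed (variableAt x y) (kron (coefficient (variableAt x y)) x y)

lin-entry : ∀ x y a → lin (entry x y) a ≡ kron (coefficient a) x y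
lin-entry x y a with variableAt x y ≟ a
... | yes refl = lin-signed-self (variableAt x y) (kron (coefficient (variableAt x y)) x y)
                                 (∣coefficient∣ x y)
... | no  ≢a   = trans (lin-signed-other (kron (coefficient (variableAt x y)) x y) ≢a)
                       (sym (coefficient-zero x y a ≢a))

design : Matrix 16 (2 ^ 10)
design i j = entry (toBits 10 i) (toBits 10 j)

gram : Fin 16 → Fin 16 → Vec Mat2 10
gram a b = zipWith _·ᵀ_ (coefficient a) (coefficient b)

XXᵀ-design : ∀ i j a b → XXᵀ design i j a b ≡ kron (gram a b) (toBits 10 i) (toBits 10 j)
XXᵀ-design = XXᵀ-kron 10 design coefficient (λ i l → lin-entry (toBits 10 i) (toBits 10 l))

topLeft : Mat2 → ℤ
topLeft M = M false false

transposeSign : Mat2 → ℤ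
transposeSign M = if does (M false true ℤ.≟ M true false) then 1ℤ else -1ℤ

gram-self-scalar : ∀ a → Scales (map topLeft (gram a a)) (gram a a) (replicate 10 identity)
gram-self-scalar = toWitness {a? = all? λ a →
  scales? (map topLeft (gram a a)) (gram a a) (replicate 10 identity)} tt

gram-self-product : ∀ a → product (map topLeft (gram a a)) ≡ + 2 ^ 6
gram-self-product = toWitness {a? = all? λ a →
  product (map topLeft (gram a a)) ℤ.≟ + 2 ^ 6} tt

gram-transposeSigns : ∀ a b → Scales (map transposeSign (gram a b)) (map transpose (gram a b)) (gram a b)
gram-transposeSigns = toWitness {a? = all? λ a → all? λ b →
  scales? (map transposeSign (gram a b)) (map transpose (gram a b)) (gram a b)} tt

gram-transposeSigns-product : ∀ a b → a ≢ b → product (map transposeSign (gram a b)) ≡ -1ℤ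
gram-transposeSigns-product a b a≢b = [ flip contradiction a≢b , id ]′ (certificate a b)
  where
  certificate : ∀ a b → a ≡ b ⊎ product (map transposeSign (gram a b)) ≡ -1ℤ
  certificate = toWitness {a? = all? λ a → all? λ b →
    a ≟ b ⊎-dec product (map transposeSign (gram a b)) ℤ.≟ -1ℤ} tt

kron-gram-self : ∀ a x y → kron (gram a a) x y ≡ + 2 ^ 6 * kron (replicate 10 identity) x y
kron-gram-self a x y = begin
  kron (gram a a) x y
    ≡⟨ kron-scale (map topLeft (gram a a)) (gram a a) (replicate 10 identity) (gram-self-scalar a) x y ⟩
  product (map topLeft (gram a a)) * kron (replicate 10 identity) x y
    ≡⟨ cong (_* kron (replicate 10 identity) x y) (gram-self-product a) ⟩
  + 2 ^ 6 * kron (replicate 10 identity) x y ∎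

kron-gram-skew : ∀ a b → a ≢ b → ∀ x y → kron (gram a b) y x ≡ - kron (gram a b) x y
kron-gram-skew a b a≢b x y = begin
  kron (gram a b) y x
    ≡⟨ kron-transpose (gram a b) x y ⟨
  kron (map transpose (gram a b)) x y
    ≡⟨ kron-scale (map transposeSign (gram a b)) (map transpose (gram a b)) (gram a b)
                  (gram-transposeSigns a b) x y ⟩
  product (map transposeSign (gram a b)) * kron (gram a b) x y
    ≡⟨ cong (_* kron (gram a b) x y) (gram-transposeSigns-product a b a≢b) ⟩
  -1ℤ * kron (gram a b) x y
    ≡⟨ ℤ.-1*i≡-i (kron (gram a b) x y) ⟩
  - kron (gram a b) x y ∎

design-diagonal : ∀ i a → XXᵀ design i i a a ≡ + 2 ^ 6
design-diagonal i a = begin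
  XXᵀ design i i a a                           ≡⟨ XXᵀ-design i i a a ⟩
  kron (gram a a) x x                          ≡⟨ kron-gram-self a x x ⟩
  + 2 ^ 6 * kron (replicate 10 identity) x x   ≡⟨ cong (+ 2 ^ 6 *_) (kron-identity-refl x) ⟩
  + 2 ^ 6 * 1ℤ                                 ≡⟨ ℤ.*-identityʳ (+ 2 ^ 6) ⟩
  + 2 ^ 6 ∎
  where x = toBits 10 i

design-offDiagonal : ∀ i j a → i ≢ j → XXᵀ design i j a a ≡ 0ℤ
design-offDiagonal i j a i≢j = begin
  XXᵀ design i j a a
    ≡⟨ XXᵀ-design i j a a ⟩
  kron (gram a a) x y
    ≡⟨ kron-gram-self a x y ⟩
  + 2 ^ 6 * kron (replicate 10 identity) x y
    ≡⟨ cong (+ 2 ^ 6 *_) (kron-identity-≢ x y (i≢j ∘ toBits-injective 10)) ⟩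
  + 2 ^ 6 * 0ℤ
    ≡⟨ ℤ.*-zeroʳ (+ 2 ^ 6) ⟩
  0ℤ ∎
  where x = toBits 10 i
        y = toBits 10 j

design-mixed : ∀ i j a b → a ≢ b → XXᵀ design i j a b + XXᵀ design j i a b ≡ 0ℤ
design-mixed i j a b a≢b = begin
  XXᵀ design i j a b + XXᵀ design j i a b
    ≡⟨ cong₂ _+_ (XXᵀ-design i j a b) (XXᵀ-design j i a b) ⟩
  kron (gram a b) x y + kron (gram a b) y x
    ≡⟨ cong (λ t → kron (gram a b) x y + t) (kron-gram-skew a b a≢b x y) ⟩
  kron (gram a b) x y - kron (gram a b) x y
    ≡⟨ ℤ.+-inverseʳ (kron (gram a b) x y) ⟩
  0ℤ ∎
  where x = toBits 10 i
        y = toBits 10 j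

theorem5p3 : Σ (Matrix 16 (2 ^ 10)) (λ X → IsOD {16} {2 ^ 10} (λ _ → 2 ^ 6) X)
theorem5p3 = design , isOD-intro (λ _ → 2 ^ 6) design design-diagonal design-offDiagonal design-mixed
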